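{- Let $G=(V,E)$ be an undirected graph with positive capacities, let $G'$ be a directed graph on $V$ with $c_{G'}(u,v)\le c_G(u,v)$ for every ordered pair $(u,v)$ (where $c_G(u,v)=c_G(v,u)$ is the capacity of edge $\{u,v\}$, or $0$ if absent), and let $R$ be an $\alpha$-congestion approximator of $G$. Then $\|R\,D_{G'}C_{G'}\|_{\infty\to\infty}\le 2$.
   Context: Index arcs by the arc set $\overleftrightarrow E$ of the bidirected graph $\overleftrightarrow G$ (arcs $(u,v),(v,u)$ for each edge $\{u,v\}$), arcs of $G'$ being among these. For a directed graph $H$ on these arcs, $C_H$ is the diagonal matrix whose $(u,v)$ entry is $c_H(u,v)$, and $D_H\in\mathbb R^{V\times\overleftrightarrow E}$ is the divergence matrix whose column for arc $(u,v)$ is $\mathbbm 1_u-\mathbbm 1_v$; thus for a congestion vector $f$ (flow $f_{(u,v)}c_H(u,v)$ on each arc), $D_HC_Hf$ is the demand (net outflows) it routes. For a demand $d$ (vector with $\sum_vd_v=0$), $OPT(d)$ is the minimum congestion $\max_{(u,v)}(\text{flow})/c_G(u,v)$ of a flow in $\overleftrightarrow G$ routing $d$. A matrix $R\in\mathbb R^{r\times V}$ is an $\alpha$-congestion approximator of $G$ if $\|Rd\|_\infty\le OPT(d)\le\alpha\|Rd\|_\infty$ for every demand $d$. $\|A\|_{\infty\to\infty}=\max_{\|v\|_\infty=1}\|Av\|_\infty$.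
   Formalization: The capacities $c_G$ and $c_{G'}$, the entries of R, and α are rational rather than real, and the demands, flows and test vectors in OPT(d) and $\|A\|_{\infty\to\infty}$ range over ℚ. -}

module Defs where

open import Data.Nat using (ℕ; zero; suc)
open import Data.Fin using (Fin; zero; suc; _≟_)
open import Data.Product using (_×_; _,_; Σ; ∃)
open import Relation.Nullary using (does)
open import Data.Bool using (if_then_else_)
open import Relation.Binary.PropositionalEquality using (_≡_)
open import Data.Rational using (ℚ; 0ℚ; 1ℚ; _+_; _*_; _-_; _⊔_; ∣_∣; _≤_; _<_)

Vect : ℕ → Set
Vect k = Fin k → ℚ

-- Arc-indexed vectors: all ordered pairs (u,v); pairs that are not arcs of the
-- bidirected graph have capacity 0 and so contribute nothing.
ArcVec : ℕ → Set
ArcVec n = Fin n → Fin n → ℚ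

sumFin : ∀ {k} → (Fin k → ℚ) → ℚ
sumFin {zero}  f = 0ℚ
sumFin {suc k} f = f zero + sumFin (λ i → f (suc i))

-- finite maximum of a nonempty-or-empty family (empty max = 0, all values used are ≥ 0)
maxFin : ∀ {k} → (Fin k → ℚ) → ℚ
maxFin {zero}  f = 0ℚ
maxFin {suc k} f = f zero ⊔ maxFin (λ i → f (suc i))

‖_‖∞ : ∀ {k} → Vect k → ℚ
‖ v ‖∞ = maxFin (λ i → ∣ v i ∣)

‖_‖∞ᴬ : ∀ {n} → ArcVec n → ℚ
‖ f ‖∞ᴬ = maxFin (λ u → maxFin (λ v → ∣ f u v ∣))

Cap : ℕ → Set
Cap n = Fin n → Fin n → ℚ

-- An undirected graph G = (V,E) with positive capacities, given by its capacity
-- function on ordered pairs: c(u,v) = c(v,u) ≥ 0, edge {u,v} ∈ E iff c(u,v) > 0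
-- (so edges have positive capacity), no self-loops.
record UndirectedCap {n : ℕ} (c : Cap n) : Set where
  field
    symmetric : ∀ u v → c u v ≡ c v u
    nonneg    : ∀ u v → 0ℚ ≤ c u v
    noLoops   : ∀ u → c u u ≡ 0ℚ

-- A directed graph G' on V whose arcs are among the arcs of the bidirected G,
-- with capacities 0 ≤ c'(u,v) ≤ c(u,v) (c'(u,v) = 0 means (u,v) is not an arc).
record DirectedSubCap {n : ℕ} (c c' : Cap n) : Set where
  field
    nonneg' : ∀ u v → 0ℚ ≤ c' u v
    below   : ∀ u v → c' u v ≤ c u v

IsDemand : ∀ {n} → Vect n → Set
IsDemand d = sumFin d ≡ 0ℚ

IsFlow : ∀ {n} → ArcVec n → Set
IsFlow g = ∀ u v → 0ℚ ≤ g u v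

Routes : ∀ {n} → ArcVec n → Vect n → Set
Routes {n} g d = ∀ u → sumFin (λ v → g u v - g v u) ≡ d u

-- congestion of g w.r.t. capacities c is at most t: g(u,v) ≤ t·c(u,v) for all (u,v)
-- (on arcs this is g(u,v)/c(u,v) ≤ t; on non-arcs it forces g(u,v) = 0)
CongAtMost : ∀ {n} → Cap n → ArcVec n → ℚ → Set
CongAtMost c g t = ∀ u v → g u v ≤ t * c u v

_·_ : ∀ {r n} → (Fin r → Fin n → ℚ) → Vect n → Vect r
(R · d) i = sumFin (λ u → R i u * d u)

-- R is an α-congestion approximator of G (capacities c):
-- for every demand d,  ‖Rd‖∞ ≤ OPT(d) ≤ α‖Rd‖∞, where OPT(d) is the minimum
-- congestion of a flow routing d (written out: every routing flow has congestion
-- ≥ ‖Rd‖∞, and some routing flow has congestion ≤ α‖Rd‖∞).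
record CongestionApproximator {r n : ℕ} (c : Cap n) (R : Fin r → Fin n → ℚ) (α : ℚ) : Set where
  field
    lower : ∀ d → IsDemand d → ∀ g t → IsFlow g → Routes g d → CongAtMost c g t →
            ‖ R · d ‖∞ ≤ t
    upper : ∀ d → IsDemand d →
            Σ (ArcVec n) (λ g → IsFlow g × Routes g d × CongAtMost c g (α * ‖ R · d ‖∞))

divergence : ∀ {n} → Fin n → Fin n → Fin n → ℚ
divergence u a b = (if does (u ≟ a) then 1ℚ else 0ℚ) - (if does (u ≟ b) then 1ℚ else 0ℚ)

RDC : ∀ {r n} → (Fin r → Fin n → ℚ) → Cap n → Fin r → Fin n → Fin n → ℚ
RDC R c' i a b = sumFin (λ u → R i u * divergence u a b) * c' a b

_·ᴬ_ : ∀ {r n} → (Fin r → Fin n → Fin n → ℚ) → ArcVec n → Vect r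
(M ·ᴬ f) i = sumFin (λ a → sumFin (λ b → M i a b * f a b))

OpNormAtMost : ∀ {r n} → (Fin r → Fin n → Fin n → ℚ) → ℚ → Set
OpNormAtMost {r} {n} M β = ∀ (f : ArcVec n) → ‖ f ‖∞ᴬ ≡ 1ℚ → ‖ M ·ᴬ f ‖∞ ≤ β

{-# OPTIONS --safe #-}
module Submission where

-- Write w(a,b) = c'(a,b) f(a,b) for an arc vector f with ‖f‖∞ = 1, so that |w| ≤ c' ≤ c.
-- Summing by parts, the entries of R D_{G'} C_{G'} f are those of R d, where d is the demand
-- of net outflows of w.  Cancelling opposite flows on each edge, (w(u,v) − w(v,u))⁺ is a
-- nonnegative flow routing the same demand d, and by the symmetry of c its congestion is at
-- most 2.  The lower bound of the congestion approximator then gives ‖R d‖∞ ≤ 2.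

open import Algebra.Bundles using (Ring)
open import Data.Bool using (if_then_else_)
open import Data.Fin using (Fin; zero; suc; _≟_)
open import Data.Nat using (ℕ; zero; suc)
open import Data.Rational using (ℚ; 0ℚ; 1ℚ; _+_; _*_; _-_; -_; _⊔_; ∣_∣; _≤_; nonNegative)
open import Data.Rational.Properties hiding (_≟_)
open import Data.Sum using (inj₁; inj₂)
open import Function using (_∘_)
open import Relation.Binary.PropositionalEquality
  using (_≡_; _≗_; refl; sym; trans; cong; cong₂; module ≡-Reasoning)
open import Relation.Nullary using (does)

open import Defs

open import Algebra.Properties.Ring +-*-ring
  using (-1*x≈-x; ⁻¹-anti-homo‿-; x[y-z]≈xy-xz; [y-z]x≈yx-zx)
open import Algebra.Properties.Semiring.Sum (Ring.semiring +-*-ring)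
  using (sum; sum-cong-≗; sum-replicate-zero; ∑-distrib-+; ∑-comm; *-distribˡ-sum)

sumFin≡sum : ∀ {k} (f : Fin k → ℚ) → sumFin f ≡ sum f
sumFin≡sum {zero}  f = refl
sumFin≡sum {suc k} f = cong (f zero +_) (sumFin≡sum (f ∘ suc))

sumFin-cong : ∀ {k} {f g : Fin k → ℚ} → f ≗ g → sumFin f ≡ sumFin g
sumFin-cong {f = f} {g} f≗g = begin
  sumFin f  ≡⟨ sumFin≡sum f ⟩
  sum f     ≡⟨ sum-cong-≗ f≗g ⟩
  sum g     ≡⟨ sumFin≡sum g ⟨
  sumFin g  ∎
  where open ≡-Reasoning

sumFin-neg : ∀ {k} (f : Fin k → ℚ) → sumFin (λ i → - f i) ≡ - sumFin f
sumFin-neg f = begin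
  sumFin (λ i → - f i)       ≡⟨ sumFin-cong (λ i → sym (-1*x≈-x (f i))) ⟩
  sumFin (λ i → - 1ℚ * f i)  ≡⟨ sumFin≡sum (λ i → - 1ℚ * f i) ⟩
  sum (λ i → - 1ℚ * f i)     ≡⟨ *-distribˡ-sum (- 1ℚ) f ⟨
  - 1ℚ * sum f               ≡⟨ -1*x≈-x (sum f) ⟩
  - sum f                    ≡⟨ cong -_ (sumFin≡sum f) ⟨
  - sumFin f                 ∎
  where open ≡-Reasoning

sumFin-distrib-+ : ∀ {k} (f g : Fin k → ℚ) → sumFin (λ i → f i + g i) ≡ sumFin f + sumFin g
sumFin-distrib-+ f g = begin
  sumFin (λ i → f i + g i)  ≡⟨ sumFin≡sum (λ i → f i + g i) ⟩
  sum (λ i → f i + g i)     ≡⟨ ∑-distrib-+ f g ⟩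
  sum f + sum g             ≡⟨ cong₂ _+_ (sumFin≡sum f) (sumFin≡sum g) ⟨
  sumFin f + sumFin g       ∎
  where open ≡-Reasoning

sumFin-distrib-- : ∀ {k} (f g : Fin k → ℚ) → sumFin (λ i → f i - g i) ≡ sumFin f - sumFin g
sumFin-distrib-- f g =
  trans (sumFin-distrib-+ f (λ i → - g i)) (cong (sumFin f +_) (sumFin-neg g))

sumFin²-distrib-- : ∀ {k m} (f g : Fin k → Fin m → ℚ) →
                    sumFin (λ i → sumFin (λ j → f i j - g i j))
                      ≡ sumFin (λ i → sumFin (f i)) - sumFin (λ i → sumFin (g i))
sumFin²-distrib-- f g =
  trans (sumFin-cong (λ i → sumFin-distrib-- (f i) (g i)))
        (sumFin-distrib-- (λ i → sumFin (f i)) (λ i → sumFin (g i)))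

*-distribˡ-sumFin : ∀ {k} x (f : Fin k → ℚ) → x * sumFin f ≡ sumFin (λ i → x * f i)
*-distribˡ-sumFin x f = begin
  x * sumFin f            ≡⟨ cong (x *_) (sumFin≡sum f) ⟩
  x * sum f               ≡⟨ *-distribˡ-sum x f ⟩
  sum (λ i → x * f i)     ≡⟨ sumFin≡sum (λ i → x * f i) ⟨
  sumFin (λ i → x * f i)  ∎
  where open ≡-Reasoning

sumFin²≡sum² : ∀ {k m} (f : Fin k → Fin m → ℚ) →
               sumFin (λ i → sumFin (f i)) ≡ sum (λ i → sum (f i))
sumFin²≡sum² f = trans (sumFin-cong (λ i → sumFin≡sum (f i))) (sumFin≡sum (λ i → sum (f i)))

sumFin-comm : ∀ {k m} (f : Fin k → Fin m → ℚ) →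
              sumFin (λ i → sumFin (f i)) ≡ sumFin (λ j → sumFin (λ i → f i j))
sumFin-comm f =
  trans (sumFin²≡sum² f) (trans (∑-comm f) (sym (sumFin²≡sum² (λ j i → f i j))))

δ : ∀ {n} → Fin n → Fin n → ℚ
δ u a = if does (u ≟ a) then 1ℚ else 0ℚ

sumFin-*δ : ∀ {n} (x : Vect n) a → sumFin (λ u → x u * δ u a) ≡ x a
sumFin-*δ {suc n} x zero = begin
  x zero * 1ℚ + sumFin (λ i → x (suc i) * 0ℚ)
    ≡⟨ cong₂ _+_ (*-identityʳ (x zero)) (sumFin-cong (*-zeroʳ ∘ x ∘ suc)) ⟩
  x zero + sumFin (λ (_ : Fin n) → 0ℚ)
    ≡⟨ cong (x zero +_) (trans (sumFin≡sum (λ (_ : Fin n) → 0ℚ)) (sum-replicate-zero n)) ⟩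
  x zero + 0ℚ
    ≡⟨ +-identityʳ (x zero) ⟩
  x zero
    ∎
  where open ≡-Reasoning
sumFin-*δ {suc n} x (suc a) =
  trans (cong₂ _+_ (*-zeroʳ (x zero)) (sumFin-*δ (x ∘ suc) a)) (+-identityˡ (x (suc a)))

sumFin-*divergence : ∀ {n} (x : Vect n) a b → sumFin (λ u → x u * divergence u a b) ≡ x a - x b
sumFin-*divergence x a b = begin
  sumFin (λ u → x u * divergence u a b)
    ≡⟨ sumFin-cong (λ u → x[y-z]≈xy-xz (x u) (δ u a) (δ u b)) ⟩
  sumFin (λ u → x u * δ u a - x u * δ u b)
    ≡⟨ sumFin-distrib-- (λ u → x u * δ u a) (λ u → x u * δ u b) ⟩
  sumFin (λ u → x u * δ u a) - sumFin (λ u → x u * δ u b)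
    ≡⟨ cong₂ _-_ (sumFin-*δ x a) (sumFin-*δ x b) ⟩
  x a - x b
    ∎
  where open ≡-Reasoning

≤maxFin : ∀ {k} (f : Fin k → ℚ) i → f i ≤ maxFin f
≤maxFin f zero    = p≤p⊔q (f zero) _
≤maxFin f (suc i) = ≤-trans (≤maxFin (f ∘ suc) i) (p≤q⊔p (f zero) _)

maxFin-cong : ∀ {k} {f g : Fin k → ℚ} → f ≗ g → maxFin f ≡ maxFin g
maxFin-cong {zero}  f≗g = refl
maxFin-cong {suc k} f≗g = cong₂ _⊔_ (f≗g zero) (maxFin-cong (f≗g ∘ suc))

‖‖∞-cong : ∀ {k} {x y : Vect k} → x ≗ y → ‖ x ‖∞ ≡ ‖ y ‖∞
‖‖∞-cong x≗y = maxFin-cong (cong ∣_∣ ∘ x≗y)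

∣f∣≤‖f‖∞ᴬ : ∀ {n} (f : ArcVec n) a b → ∣ f a b ∣ ≤ ‖ f ‖∞ᴬ
∣f∣≤‖f‖∞ᴬ f a b =
  ≤-trans (≤maxFin (λ v → ∣ f a v ∣) b) (≤maxFin (λ u → maxFin (λ v → ∣ f u v ∣)) a)

p≤∣p∣ : ∀ p → p ≤ ∣ p ∣
p≤∣p∣ p with ≤-total 0ℚ p
... | inj₁ 0≤p = ≤-reflexive (sym (0≤p⇒∣p∣≡p 0≤p))
... | inj₂ p≤0 = ≤-trans p≤0 (0≤∣p∣ p)

p≤q⇒p-q≤0 : ∀ {p q} → p ≤ q → p - q ≤ 0ℚ
p≤q⇒p-q≤0 {p} {q} p≤q = ≤-trans (+-monoˡ-≤ (- q) p≤q) (≤-reflexive (+-inverseʳ q))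

p≤q⇒0≤q-p : ∀ {p q} → p ≤ q → 0ℚ ≤ q - p
p≤q⇒0≤q-p {p} {q} p≤q = ≤-trans (≤-reflexive (sym (+-inverseʳ p))) (+-monoˡ-≤ (- p) p≤q)

2*p≡p+p : ∀ p → (1ℚ + 1ℚ) * p ≡ p + p
2*p≡p+p p = trans (*-distribʳ-+ p 1ℚ 1ℚ) (cong₂ _+_ (*-identityˡ p) (*-identityˡ p))

_⁺ : ℚ → ℚ
p ⁺ = 0ℚ ⊔ p

[p-q]⁺-[q-p]⁺≡p-q : ∀ p q → (p - q) ⁺ - (q - p) ⁺ ≡ p - q
[p-q]⁺-[q-p]⁺≡p-q p q with ≤-total p q
... | inj₁ p≤q = begin
  (p - q) ⁺ - (q - p) ⁺  ≡⟨ cong₂ _-_ (p≥q⇒p⊔q≡p (p≤q⇒p-q≤0 p≤q)) (p≤q⇒p⊔q≡q (p≤q⇒0≤q-p p≤q)) ⟩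
  0ℚ - (q - p)           ≡⟨ +-identityˡ (- (q - p)) ⟩
  - (q - p)              ≡⟨ ⁻¹-anti-homo‿- q p ⟩
  p - q                  ∎
  where open ≡-Reasoning
... | inj₂ q≤p = begin
  (p - q) ⁺ - (q - p) ⁺  ≡⟨ cong₂ _-_ (p≤q⇒p⊔q≡q (p≤q⇒0≤q-p q≤p)) (p≥q⇒p⊔q≡p (p≤q⇒p-q≤0 q≤p)) ⟩
  (p - q) - 0ℚ           ≡⟨ +-identityʳ (p - q) ⟩
  p - q                  ∎
  where open ≡-Reasoning

·-congˡ : ∀ {r n} (R : Fin r → Fin n → ℚ) {d e : Vect n} → d ≗ e → R · d ≗ R · e
·-congˡ R d≗e i = sumFin-cong (λ u → cong (R i u *_) (d≗e u))

netOutflow : ∀ {n} → ArcVec n → Vect n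
netOutflow g u = sumFin (λ v → g u v - g v u)

netOutflow-isDemand : ∀ {n} (g : ArcVec n) → IsDemand (netOutflow g)
netOutflow-isDemand g = begin
  sumFin (λ u → sumFin (λ v → g u v - g v u))  ≡⟨ sumFin²-distrib-- g (λ u v → g v u) ⟩
  out - sumFin (λ u → sumFin (λ v → g v u))    ≡⟨ cong (_-_ out) (sumFin-comm g) ⟨
  out - out                                    ≡⟨ +-inverseʳ out ⟩
  0ℚ                                           ∎
  where
  open ≡-Reasoning
  out : ℚ
  out = sumFin (λ u → sumFin (g u))

sumFin-*netOutflow : ∀ {n} (x : Vect n) (w : ArcVec n) →
                     sumFin (λ u → x u * netOutflow w u)
                       ≡ sumFin (λ a → sumFin (λ b → (x a - x b) * w a b))
sumFin-*netOutflow x w = begin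
  sumFin (λ u → x u * netOutflow w u)
    ≡⟨ sumFin-cong (λ u → *-distribˡ-sumFin (x u) (λ v → w u v - w v u)) ⟩
  sumFin (λ u → sumFin (λ v → x u * (w u v - w v u)))
    ≡⟨ sumFin-cong (λ u → sumFin-cong (λ v → x[y-z]≈xy-xz (x u) (w u v) (w v u))) ⟩
  sumFin (λ u → sumFin (λ v → x u * w u v - x u * w v u))
    ≡⟨ sumFin²-distrib-- (λ u v → x u * w u v) (λ u v → x u * w v u) ⟩
  out - sumFin (λ u → sumFin (λ v → x u * w v u))
    ≡⟨ cong (_-_ out) (sumFin-comm (λ a b → x b * w a b)) ⟨
  out - sumFin (λ a → sumFin (λ b → x b * w a b))
    ≡⟨ sumFin²-distrib-- (λ a b → x a * w a b) (λ a b → x b * w a b) ⟨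
  sumFin (λ a → sumFin (λ b → x a * w a b - x b * w a b))
    ≡⟨ sumFin-cong (λ a → sumFin-cong (λ b → [y-z]x≈yx-zx (w a b) (x a) (x b))) ⟨
  sumFin (λ a → sumFin (λ b → (x a - x b) * w a b))
    ∎
  where
  open ≡-Reasoning
  out : ℚ
  out = sumFin (λ a → sumFin (λ b → x a * w a b))

RDC·ᴬ≗R·netOutflow : ∀ {r n} (R : Fin r → Fin n → ℚ) (c' : Cap n) (f : ArcVec n) →
                     RDC R c' ·ᴬ f ≗ R · netOutflow (λ a b → c' a b * f a b)
RDC·ᴬ≗R·netOutflow R c' f i = begin
  sumFin (λ a → sumFin (λ b → sumFin (λ u → R i u * divergence u a b) * c' a b * f a b))
    ≡⟨ sumFin-cong (λ a → sumFin-cong (λ b → entry a b)) ⟩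
  sumFin (λ a → sumFin (λ b → (R i a - R i b) * (c' a b * f a b)))
    ≡⟨ sumFin-*netOutflow (R i) (λ a b → c' a b * f a b) ⟨
  sumFin (λ u → R i u * netOutflow (λ a b → c' a b * f a b) u)
    ∎
  where
  open ≡-Reasoning
  entry : ∀ a b → sumFin (λ u → R i u * divergence u a b) * c' a b * f a b
                    ≡ (R i a - R i b) * (c' a b * f a b)
  entry a b = trans (cong (λ s → s * c' a b * f a b) (sumFin-*divergence (R i) a b))
                    (*-assoc (R i a - R i b) (c' a b) (f a b))

netFlow : ∀ {n} → ArcVec n → ArcVec n
netFlow w u v = (w u v - w v u) ⁺

netFlow-isFlow : ∀ {n} (w : ArcVec n) → IsFlow (netFlow w)
netFlow-isFlow w u v = p≤p⊔q 0ℚ (w u v - w v u)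

netOutflow-netFlow : ∀ {n} (w : ArcVec n) → netOutflow (netFlow w) ≗ netOutflow w
netOutflow-netFlow w u = sumFin-cong (λ v → [p-q]⁺-[q-p]⁺≡p-q (w u v) (w v u))

netFlow-congestion : ∀ {n} {c : Cap n} {w : ArcVec n} → (∀ u v → c u v ≡ c v u) →
                     (∀ u v → ∣ w u v ∣ ≤ c u v) → CongAtMost c (netFlow w) (1ℚ + 1ℚ)
netFlow-congestion {c = c} {w} c-sym ∣w∣≤c u v =
  ≤-trans (⊔-lub 0≤c+c w-difference≤c+c) (≤-reflexive (sym (2*p≡p+p (c u v))))
  where
  open ≤-Reasoning
  0≤c : 0ℚ ≤ c u v
  0≤c = ≤-trans (0≤∣p∣ (w u v)) (∣w∣≤c u v)
  0≤c+c : 0ℚ ≤ c u v + c u v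
  0≤c+c = +-mono-≤ 0≤c 0≤c
  w-difference≤c+c : w u v - w v u ≤ c u v + c u v
  w-difference≤c+c = begin
    w u v - w v u          ≤⟨ p≤∣p∣ (w u v - w v u) ⟩
    ∣ w u v - w v u ∣      ≤⟨ ∣p-q∣≤∣p∣+∣q∣ (w u v) (w v u) ⟩
    ∣ w u v ∣ + ∣ w v u ∣  ≤⟨ +-mono-≤ (∣w∣≤c u v) (∣w∣≤c v u) ⟩
    c u v + c v u          ≡⟨ cong (c u v +_) (c-sym v u) ⟩
    c u v + c u v          ∎

‖R·netOutflow‖∞≤2 : ∀ {r n} {c : Cap n} {R : Fin r → Fin n → ℚ} {α : ℚ} →
                    CongestionApproximator c R α → (∀ u v → c u v ≡ c v u) →
                    (w : ArcVec n) → (∀ u v → ∣ w u v ∣ ≤ c u v) →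
                    ‖ R · netOutflow w ‖∞ ≤ 1ℚ + 1ℚ
‖R·netOutflow‖∞≤2 {R = R} approx c-sym w ∣w∣≤c = begin
  ‖ R · netOutflow w ‖∞            ≡⟨ ‖‖∞-cong (·-congˡ R (netOutflow-netFlow w)) ⟨
  ‖ R · netOutflow (netFlow w) ‖∞  ≤⟨ lower d (netOutflow-isDemand (netFlow w))
                                            (netFlow w) (1ℚ + 1ℚ) (netFlow-isFlow w) (λ _ → refl)
                                            (netFlow-congestion c-sym ∣w∣≤c) ⟩
  1ℚ + 1ℚ                          ∎
  where
  open ≤-Reasoning
  open CongestionApproximator approx
  d : Vect _
  d = netOutflow (netFlow w)

∣c'*f∣≤c : ∀ {n} {c c' : Cap n} → DirectedSubCap c c' → (f : ArcVec n) → ‖ f ‖∞ᴬ ≤ 1ℚ →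
           ∀ a b → ∣ c' a b * f a b ∣ ≤ c a b
∣c'*f∣≤c {c = c} {c'} sub f ‖f‖≤1 a b = begin
  ∣ c' a b * f a b ∣      ≡⟨ ∣p*q∣≡∣p∣*∣q∣ (c' a b) (f a b) ⟩
  ∣ c' a b ∣ * ∣ f a b ∣  ≡⟨ cong (_* ∣ f a b ∣) (0≤p⇒∣p∣≡p (nonneg' a b)) ⟩
  c' a b * ∣ f a b ∣      ≤⟨ *-monoˡ-≤-nonNeg (c' a b) {{nonNegative (nonneg' a b)}} ∣f∣≤1 ⟩
  c' a b * 1ℚ             ≡⟨ *-identityʳ (c' a b) ⟩
  c' a b                  ≤⟨ below a b ⟩
  c a b                   ∎
  where
  open ≤-Reasoning
  open DirectedSubCap sub
  ∣f∣≤1 : ∣ f a b ∣ ≤ 1ℚ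
  ∣f∣≤1 = ≤-trans (∣f∣≤‖f‖∞ᴬ f a b) ‖f‖≤1

lemma9 : ∀ {n r : ℕ} (c c' : Cap n) (R : Fin r → Fin n → ℚ) (α : ℚ) →
    UndirectedCap c → DirectedSubCap c c' → CongestionApproximator c R α →
    OpNormAtMost (RDC R c') (1ℚ + 1ℚ)
lemma9 {n} c c' R α undirected sub approx f ‖f‖≡1 = begin
  ‖ RDC R c' ·ᴬ f ‖∞     ≡⟨ ‖‖∞-cong (RDC·ᴬ≗R·netOutflow R c' f) ⟩
  ‖ R · netOutflow w ‖∞  ≤⟨ ‖R·netOutflow‖∞≤2 approx (UndirectedCap.symmetric undirected)
                                                w (∣c'*f∣≤c sub f (≤-reflexive ‖f‖≡1)) ⟩
  1ℚ + 1ℚ                ∎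
  where
  open ≤-Reasoning
  w : ArcVec n
  w a b = c' a b * f a b
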